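{- Let $T_h$ be the perfect binary tree of height $h = 3m + t \geq 4$, with $0 \leq t \leq 2$. Then \[ M_c(T_h) \leq 2^{t+1} \cdot \frac{8^m - 1}{7} + 2^{h-1} + b_t, \] where $b_0 = 1$, $b_1 = 1$, $b_2 = 2$.
   Context: For a graph $G$, $d(u,v)$ is the distance, $\mathrm{ecc}(v)$ the eccentricity of $v$, and $N_r[v] = \{u : d(u,v) \le r\}$. A multicover of $G$ is a set $S \subseteq V(G)$ such that $|N_r[v]\cap S| \ge r$ for every $v \in V(G)$ and every $1 \le r \le \mathrm{ecc}(v)$; $M_c(G)$ is the minimum size of a multicover. The perfect binary tree $T_h$ is the rooted tree in which every non-leaf vertex has exactly $2$ children and all leaves are at distance $h$ from the root. -}

module Defs where

open import Data.Nat using (ℕ; zero; suc; _+_; _*_; _∸_; _^_; _≤_; _⊔_; _≡ᵇ_)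
open import Data.Product using (Σ; _×_)
open import Data.Bool using (Bool; true; false; _∧_; _∨_; not; if_then_else_)
open import Data.Fin using (Fin; toℕ)
open import Data.Fin.Subset using (Subset; ∣_∣)
open import Data.Vec using (Vec; lookup; allFin; foldr; map)
open import Data.List as L using (List)

-- A finite simple graph on the vertex set Fin n, with a Boolean adjacency
-- relation (assumed symmetric / irreflexive by construction of instances).
record Graph : Set where
  field
    n   : ℕ
    adj : Fin n → Fin n → Bool

module _ (G : Graph) where
  open Graph G

  anyV : (Fin n → Bool) → Bool
  anyV p = foldr _ (λ x b → p x ∨ b) false (allFin n)

  countV : (Fin n → Bool) → ℕ
  countV p = foldr _ (λ x k → if p x then suc k else k) 0 (allFin n)

  maxV : (Fin n → ℕ) → ℕ
  maxV f = foldr _ (λ x k → f x ⊔ k) 0 (allFin n)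

  eqV : Fin n → Fin n → Bool
  eqV u v = toℕ u ≡ᵇ toℕ v

  within : ℕ → Fin n → Fin n → Bool
  within zero    u v = eqV u v
  within (suc r) u v = within r u v ∨ anyV (λ w → within r u w ∧ adj w v)

  -- d(u,v): the least r ≤ n with d(u,v) ≤ r (graphs considered are connected,
  -- so the distance is < n and this is the graph distance)
  distFrom : ℕ → ℕ → Fin n → Fin n → ℕ
  distFrom r zero    u v = r
  distFrom r (suc k) u v = if within r u v then r else distFrom (suc r) k u v

  dist : Fin n → Fin n → ℕ
  dist u v = distFrom 0 n u v

  ecc : Fin n → ℕ
  ecc v = maxV (λ u → dist u v)

  ballCount : Subset n → ℕ → Fin n → ℕ
  ballCount S r v = countV (λ u → lookup S u ∧ within r u v)

  IsMulticover : Subset n → Set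
  IsMulticover S = ∀ (v : Fin n) (r : ℕ) → 1 ≤ r → r ≤ ecc v → r ≤ ballCount S r v

  McAtMost : ℕ → Set
  McAtMost k = Σ (Subset n) (λ S → IsMulticover S × ∣ S ∣ ≤ k)

-- The perfect binary tree T_h, in heap numbering: vertices 0 … 2^(h+1) - 2,
-- root 0, children of i are 2i+1 and 2i+2.
childOf : ℕ → ℕ → Bool
childOf i j = (j ≡ᵇ (2 * i + 1)) ∨ (j ≡ᵇ (2 * i + 2))

T : ℕ → Graph
T h = record
  { n   = 2 ^ (suc h) ∸ 1
  ; adj = λ u v → childOf (toℕ u) (toℕ v) ∨ childOf (toℕ v) (toℕ u)
  }

b : ℕ → ℕ
b 0 = 1
b 1 = 1
b _ = 2

-- Take S to be the full levels 0, h - 1 and t + 1 + 3i (i < m) of T_h, plus the vertex 1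
-- when t = 2; the levels t + 1 + 3i contribute 2^(t+1) (8^m - 1) / 7 vertices. If the
-- ancestor of v lying j levels above it has its descendants on a level of S exactly k
-- levels below it, these 2^k vertices lie in N_r[v] as soon as j + k ≤ r. Every three
-- consecutive levels contain one of S, so a ball that does not reach depth h - 2 sees
-- 2^k ≥ r such descendants of v itself with r - 2 ≤ k ≤ r (the cases r ≤ 3 are checked
-- by hand), while a ball that reaches depth h - 2 contains a block on each of the levels
-- h - 2 and h - 1, and taking the ancestors as high as the radius allows makes their total
-- size at least r.

module Submission where

open import Defs
open import Data.Bool using (Bool; true; false; _∧_; _∨_; if_then_else_)
open import Data.Bool.Properties using (∨-zeroʳ; T-≡; T-∧)
open import Data.Empty using (⊥-elim)
open import Data.Fin as Fin using (Fin; toℕ; fromℕ<)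
open import Data.Fin.Properties using (toℕ-injective; toℕ-fromℕ<; toℕ<n)
open import Data.Fin.Subset using (Subset; ∣_∣)
open import Data.List using (_∷_; [])
open import Data.Nat
open import Data.Nat.DivMod using (_/_; _%_; m≡m%n+[m/n]*n; m%n<n; m<n*o⇒m/o<n; m*n/n≡m)
open import Data.Nat.Properties
open import Data.Nat.Tactic.RingSolver using (solve; solve-∀)
open import Data.Product using (Σ; _×_; _,_)
open import Data.Sum using (_⊎_; inj₁; inj₂)
open import Data.Vec using (tabulate; foldr; lookup)
open import Data.Vec.Properties using (lookup∘tabulate)
open import Function using (_∘_; id)
open import Function.Bundles using (module Equivalence)
open import Relation.Binary.PropositionalEquality
open import Relation.Nullary using (yes; no)
open import Algebra.Properties.CommutativeSemigroup +-commutativeSemigroup using (interchange)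

⟦_⟧ : Bool → ℕ
⟦ true  ⟧ = 1
⟦ false ⟧ = 0

⟦∨⟧≤ : ∀ a b → ⟦ a ∨ b ⟧ ≤ ⟦ a ⟧ + ⟦ b ⟧
⟦∨⟧≤ true  _ = s≤s z≤n
⟦∨⟧≤ false _ = ≤-refl

≡ᵇ⇒≡-true : ∀ {m n} → (m ≡ᵇ n) ≡ true → m ≡ n
≡ᵇ⇒≡-true {m} {n} e = ≡ᵇ⇒≡ m n (Equivalence.from T-≡ e)

≡⇒≡ᵇ-true : ∀ {m n} → m ≡ n → (m ≡ᵇ n) ≡ true
≡⇒≡ᵇ-true {m} {n} e = Equivalence.to T-≡ (≡⇒≡ᵇ m n e)

sumFrom : (ℕ → ℕ) → ℕ → ℕ → ℕ
sumFrom f o zero    = 0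
sumFrom f o (suc n) = f o + sumFrom f (suc o) n

countFrom : (ℕ → Bool) → ℕ → ℕ → ℕ
countFrom Q = sumFrom (⟦_⟧ ∘ Q)

sumFrom-++ : ∀ f o a b → sumFrom f o (a + b) ≡ sumFrom f o a + sumFrom f (o + a) b
sumFrom-++ f o zero    b rewrite +-identityʳ o = refl
sumFrom-++ f o (suc a) b rewrite sumFrom-++ f (suc o) a b | +-suc o a =
  sym (+-assoc (f o) _ _)

sumFrom-mono : ∀ {f g} o n → (∀ x → f x ≤ g x) → sumFrom f o n ≤ sumFrom g o n
sumFrom-mono o zero    f≤g = z≤n
sumFrom-mono o (suc n) f≤g = +-mono-≤ (f≤g o) (sumFrom-mono (suc o) n f≤g)

sumFrom-+ : ∀ f g o n → sumFrom (λ x → f x + g x) o n ≡ sumFrom f o n + sumFrom g o n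
sumFrom-+ f g o zero    = refl
sumFrom-+ f g o (suc n) rewrite sumFrom-+ f g (suc o) n =
  interchange (f o) (g o) (sumFrom f (suc o) n) (sumFrom g (suc o) n)

sumFrom-shift : ∀ f o n → sumFrom f (suc o) n ≡ sumFrom (f ∘ suc) o n
sumFrom-shift f o zero    = refl
sumFrom-shift f o (suc n) = cong (f (suc o) +_) (sumFrom-shift f (suc o) n)

sumFrom-const : ∀ f c o n → (∀ x → o ≤ x → x < o + n → f x ≡ c) → sumFrom f o n ≡ c * n
sumFrom-const f c o zero    _   = sym (*-zeroʳ c)
sumFrom-const f c o (suc n) f≡c
  rewrite f≡c o ≤-refl (m<m+n o z<s)
        | sumFrom-const f c (suc o) n λ x o<x x< →
            f≡c x (<⇒≤ o<x) (subst (x <_) (sym (+-suc o n)) x<)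
  = sym (*-suc c n)

sumFrom-prefix : ∀ f o a b → sumFrom f o a ≤ sumFrom f o (a + b)
sumFrom-prefix f o a b = subst (sumFrom f o a ≤_) (sym (sumFrom-++ f o a b)) (m≤m+n _ _)

sumFrom-suffix : ∀ f o a b → sumFrom f (o + a) b ≤ sumFrom f o (a + b)
sumFrom-suffix f o a b = subst (sumFrom f (o + a) b ≤_) (sym (sumFrom-++ f o a b)) (m≤n+m _ _)

sumFrom-⊆ : ∀ f a l {n} → a + l ≤ n → sumFrom f a l ≤ sumFrom f 0 n
sumFrom-⊆ f a l a+l≤n with m≤n⇒∃[o]m+o≡n a+l≤n
... | k , refl = begin
  sumFrom f a l             ≤⟨ sumFrom-prefix f a l k ⟩
  sumFrom f a (l + k)       ≤⟨ sumFrom-suffix f 0 a (l + k) ⟩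
  sumFrom f 0 (a + (l + k)) ≡⟨ cong (sumFrom f 0) (+-assoc a l k) ⟨
  sumFrom f 0 (a + l + k)   ∎
  where open ≤-Reasoning

sumFrom-disjoint : ∀ f a₁ l₁ a₂ l₂ {n} → a₁ + l₁ ≤ a₂ → a₂ + l₂ ≤ n →
  sumFrom f a₁ l₁ + sumFrom f a₂ l₂ ≤ sumFrom f 0 n
sumFrom-disjoint f a₁ l₁ a₂ l₂ before after with m≤n⇒∃[o]m+o≡n after
... | k , refl = begin
  sumFrom f a₁ l₁ + sumFrom f a₂ l₂         ≤⟨ +-mono-≤ (sumFrom-⊆ f a₁ l₁ before) (sumFrom-prefix f a₂ l₂ k) ⟩
  sumFrom f 0 a₂ + sumFrom f a₂ (l₂ + k)    ≡⟨ sumFrom-++ f 0 a₂ (l₂ + k) ⟨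
  sumFrom f 0 (a₂ + (l₂ + k))               ≡⟨ cong (sumFrom f 0) (+-assoc a₂ l₂ k) ⟨
  sumFrom f 0 (a₂ + l₂ + k)                 ∎
  where open ≤-Reasoning

sumFrom-snoc : ∀ f o n → sumFrom f o (suc n) ≡ sumFrom f o n + f (o + n)
sumFrom-snoc f o zero    = trans (+-identityʳ (f o)) (cong f (sym (+-identityʳ o)))
sumFrom-snoc f o (suc n) rewrite sumFrom-snoc f (suc o) n | +-suc o n = sym (+-assoc (f o) _ _)

sumFrom-∨ : ∀ (A B : ℕ → Bool) (g : ℕ → ℕ) o n →
  sumFrom (λ x → ⟦ A x ∨ B x ⟧ * g x) o n ≤ sumFrom (λ x → ⟦ A x ⟧ * g x) o n + sumFrom (λ x → ⟦ B x ⟧ * g x) o n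
sumFrom-∨ A B g o n = ≤-trans
  (sumFrom-mono o n λ x → ≤-trans (*-monoˡ-≤ (g x) (⟦∨⟧≤ (A x) (B x))) (≤-reflexive (*-distribʳ-+ (g x) ⟦ A x ⟧ ⟦ B x ⟧)))
  (≤-reflexive (sumFrom-+ (λ x → ⟦ A x ⟧ * g x) (λ x → ⟦ B x ⟧ * g x) o n))

sumFrom-beyond : ∀ (Q : ℕ → Bool) (g : ℕ → ℕ) c n → (∀ x → Q x ≡ true → x ≡ c) →
  sumFrom (λ x → ⟦ Q x ⟧ * g x) (suc c) n ≡ 0
sumFrom-beyond Q g c n Q⇒c = sumFrom-const _ 0 (suc c) n vanish
  where
  vanish : ∀ x → suc c ≤ x → x < suc c + n → ⟦ Q x ⟧ * g x ≡ 0
  vanish x c<x _ with Q x in Qx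
  ... | false = refl
  ... | true  = ⊥-elim (<-irrefl (sym (Q⇒c x Qx)) c<x)

sumFrom-single : ∀ (Q : ℕ → Bool) (g : ℕ → ℕ) c o n → (∀ x → Q x ≡ true → x ≡ c) →
  sumFrom (λ x → ⟦ Q x ⟧ * g x) o n ≤ g c
sumFrom-single Q g c o zero    _   = z≤n
sumFrom-single Q g c o (suc n) Q⇒c with Q o in Qo
... | false = sumFrom-single Q g c (suc o) n Q⇒c
... | true rewrite Q⇒c o Qo | sumFrom-beyond Q g c n Q⇒c =
  ≤-reflexive (trans (+-identityʳ _) (+-identityʳ (g c)))

countFrom-all : ∀ Q o n → (∀ x → o ≤ x → x < o + n → Q x ≡ true) → n ≤ countFrom Q o n
countFrom-all Q o n allQ = ≤-reflexive (sym (trans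
  (sumFrom-const (⟦_⟧ ∘ Q) 1 o n (λ x o≤x x< → cong ⟦_⟧ (allQ x o≤x x<))) (*-identityˡ n)))

countFrom-∨ : ∀ A B o n → countFrom (λ x → A x ∨ B x) o n ≤ countFrom A o n + countFrom B o n
countFrom-∨ A B o n = ≤-trans (sumFrom-mono o n (λ x → ⟦∨⟧≤ (A x) (B x)))
                               (≤-reflexive (sumFrom-+ (⟦_⟧ ∘ A) (⟦_⟧ ∘ B) o n))

∣tabulate∣≡countFrom : ∀ n (Q : ℕ → Bool) → ∣ tabulate {n = n} (Q ∘ toℕ) ∣ ≡ countFrom Q 0 n
∣tabulate∣≡countFrom zero    Q = refl
∣tabulate∣≡countFrom (suc n) Q
  rewrite sumFrom-shift (⟦_⟧ ∘ Q) 0 n | sym (∣tabulate∣≡countFrom n (Q ∘ suc)) with Q 0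
... | true  = refl
... | false = refl

countFrom≤foldr : ∀ {N} n (p : Fin N → Bool) (g : Fin n → Fin N) (Q : ℕ → Bool) →
  (∀ i → Q (toℕ i) ≡ true → p (g i) ≡ true) →
  countFrom Q 0 n ≤ foldr _ (λ x k → if p x then suc k else k) 0 (tabulate g)
countFrom≤foldr zero    p g Q Q⇒p = z≤n
countFrom≤foldr (suc n) p g Q Q⇒p
  rewrite sumFrom-shift (⟦_⟧ ∘ Q) 0 n with Q 0 in Q0 | p (g Fin.zero) in pg0
... | true  | true  = s≤s (countFrom≤foldr n p (g ∘ Fin.suc) (Q ∘ suc) (Q⇒p ∘ Fin.suc))
... | true  | false with () ← trans (sym (Q⇒p Fin.zero Q0)) pg0
... | false | true  = m≤n⇒m≤1+n (countFrom≤foldr n p (g ∘ Fin.suc) (Q ∘ suc) (Q⇒p ∘ Fin.suc))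
... | false | false = countFrom≤foldr n p (g ∘ Fin.suc) (Q ∘ suc) (Q⇒p ∘ Fin.suc)

countFrom≤countV : ∀ G p (Q : ℕ → Bool) → (∀ i → Q (toℕ i) ≡ true → p i ≡ true) →
  countFrom Q 0 (Graph.n G) ≤ countV G p
countFrom≤countV G p Q = countFrom≤foldr (Graph.n G) p id Q

any-tabulate : ∀ {N k} (p : Fin N → Bool) (g : Fin k → Fin N) i → p (g i) ≡ true →
  foldr _ (λ x b → p x ∨ b) false (tabulate g) ≡ true
any-tabulate p g Fin.zero    pgi rewrite pgi = refl
any-tabulate p g (Fin.suc i) pgi rewrite any-tabulate p (g ∘ Fin.suc) i pgi = ∨-zeroʳ (p (g Fin.zero))

max-tabulate≤ : ∀ {N k} (f : Fin N → ℕ) (g : Fin k → Fin N) c → (∀ i → f (g i) ≤ c) →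
  foldr _ (λ x m → f x ⊔ m) 0 (tabulate g) ≤ c
max-tabulate≤ {k = zero}  f g c f≤c = z≤n
max-tabulate≤ {k = suc k} f g c f≤c = ⊔-lub (f≤c Fin.zero) (max-tabulate≤ f (g ∘ Fin.suc) c (f≤c ∘ Fin.suc))

module _ (G : Graph) where

  within-refl : ∀ r u → within G r u u ≡ true
  within-refl zero    u = ≡⇒≡ᵇ-true {toℕ u} refl
  within-refl (suc r) u rewrite within-refl r u = refl

  within-suc : ∀ {r u v} → within G r u v ≡ true → within G (suc r) u v ≡ true
  within-suc uv rewrite uv = refl

  within-step : ∀ {r u w v} → within G r u w ≡ true → Graph.adj G w v ≡ true →
    within G (suc r) u v ≡ true
  within-step {r} {u} {w} {v} uw wv = trans
    (cong (within G r u v ∨_) (any-tabulate (λ w′ → within G r u w′ ∧ Graph.adj G w′ v) id w (cong₂ _∧_ uw wv)))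
    (∨-zeroʳ _)

  distFrom≤ : ∀ {k u v} r fuel → within G k u v ≡ true → r ≤ k → distFrom G r fuel u v ≤ k
  distFrom≤         r zero       _  r≤k = r≤k
  distFrom≤ {k} {u} {v} r (suc fuel) uv r≤k with within G r u v in uvʳ
  ... | true  = r≤k
  ... | false = distFrom≤ (suc r) fuel uv (≤∧≢⇒< r≤k r≢k)
    where
    r≢k : r ≢ k
    r≢k refl with () ← trans (sym uvʳ) uv

  dist≤ : ∀ {k u v} → within G k u v ≡ true → dist G u v ≤ k
  dist≤ uv = distFrom≤ 0 (Graph.n G) uv z≤n

  ecc≤ : ∀ v c → (∀ u → dist G u v ≤ c) → ecc G v ≤ c
  ecc≤ v c = max-tabulate≤ (λ u → dist G u v) id c

-- Heap numbering: depth l occupies the indices [levelStart l, levelStart l + 2 ^ l).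
levelStart : ℕ → ℕ
levelStart zero    = 0
levelStart (suc l) = suc (2 * levelStart l)

suc-levelStart : ∀ l → suc (levelStart l) ≡ 2 ^ l
suc-levelStart zero    = refl
suc-levelStart (suc l) rewrite sym (suc-levelStart l) =
  cong suc (sym (+-suc (levelStart l) (levelStart l + 0)))

levelStart-suc : ∀ l → levelStart (suc l) ≡ levelStart l + 2 ^ l
levelStart-suc l rewrite sym (suc-levelStart l) =
  trans (cong suc (cong (levelStart l +_) (+-identityʳ (levelStart l)))) (sym (+-suc (levelStart l) (levelStart l)))

levelStart-mono-≤ : ∀ {l l′} → l ≤ l′ → levelStart l ≤ levelStart l′
levelStart-mono-≤ {zero}              _         = z≤n
levelStart-mono-≤ {suc l} {suc l′} (s≤s l≤l′) = s≤s (*-monoʳ-≤ 2 (levelStart-mono-≤ l≤l′))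

levelStart+offset< : ∀ {h l s} → l ≤ h → s < 2 ^ l → levelStart l + s < levelStart (suc h)
levelStart+offset< {h} {l} {s} l≤h s< = ≤-trans
  (subst (levelStart l + s <_) (sym (levelStart-suc l)) (+-monoʳ-< (levelStart l) s<))
  (levelStart-mono-≤ (s≤s l≤h))

∣T∣≡levelStart : ∀ h → Graph.n (T h) ≡ levelStart (suc h)
∣T∣≡levelStart h = cong (_∸ 1) (sym (suc-levelStart (suc h)))

record Position (h x : ℕ) : Set where
  constructor position
  field
    depth   : ℕ
    offset  : ℕ
    depth≤h : depth ≤ h
    offset< : offset < 2 ^ depth
    index   : x ≡ levelStart depth + offset

position-of : ∀ h x → x < levelStart (suc h) → Position h x
position-of zero    x       (s≤s z≤n) = position 0 0 z≤n (s≤s z≤n) refl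
position-of (suc h) x x< with x <? levelStart (suc h)
... | yes x<start = let position l s l≤h s< x≡ = position-of h x x<start in position l s (m≤n⇒m≤1+n l≤h) s< x≡
... | no  x≮start = position (suc h) (x ∸ levelStart (suc h)) ≤-refl offset< (sym x≡)
  where
  x≡ : levelStart (suc h) + (x ∸ levelStart (suc h)) ≡ x
  x≡ = m+[n∸m]≡n (≮⇒≥ x≮start)
  offset< : x ∸ levelStart (suc h) < 2 ^ suc h
  offset< = +-cancelˡ-< (levelStart (suc h)) _ _
    (subst₂ _<_ (sym x≡) (levelStart-suc (suc h)) x<)

childOf-2i+1+e : ∀ i e → e < 2 → childOf i (2 * i + 1 + e) ≡ true
childOf-2i+1+e i zero          _ = cong (_∨ (2 * i + 1 + 0 ≡ᵇ 2 * i + 2)) (≡⇒≡ᵇ-true (+-identityʳ (2 * i + 1)))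
childOf-2i+1+e i (suc zero)    _ =
  trans (cong ((2 * i + 1 + 1 ≡ᵇ 2 * i + 1) ∨_) (≡⇒≡ᵇ-true (+-assoc (2 * i) 1 1))) (∨-zeroʳ _)
childOf-2i+1+e i (suc (suc e)) (s≤s (s≤s ()))

childOf-levelStart : ∀ L a e → e < 2 →
  childOf (levelStart L + a) (levelStart (suc L) + (2 * a + e)) ≡ true
childOf-levelStart L a e e<2 =
  subst (λ j → childOf (levelStart L + a) j ≡ true) (sym (child≡ (levelStart L) a e))
    (childOf-2i+1+e (levelStart L + a) e e<2)
  where
  child≡ : ∀ p a e → suc (2 * p) + (2 * a + e) ≡ 2 * (p + a) + 1 + e
  child≡ = solve-∀

descendantBlock≤ : ∀ l k s → s < 2 ^ l → s * 2 ^ k + 2 ^ k ≤ 2 ^ (l + k)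
descendantBlock≤ l k s s< = begin
  s * 2 ^ k + 2 ^ k  ≡⟨ +-comm (s * 2 ^ k) (2 ^ k) ⟩
  suc s * 2 ^ k      ≤⟨ *-monoˡ-≤ (2 ^ k) s< ⟩
  2 ^ l * 2 ^ k      ≡⟨ ^-distribˡ-+-* 2 l k ⟨
  2 ^ (l + k)        ∎
  where open ≤-Reasoning

descendantOffset< : ∀ l k s q → s < 2 ^ l → q < 2 ^ k → s * 2 ^ k + q < 2 ^ (l + k)
descendantOffset< l k s q s< q< = <-≤-trans (+-monoʳ-< (s * 2 ^ k) q<) (descendantBlock≤ l k s s<)

half< : ∀ k q → q < 2 ^ suc k → q / 2 < 2 ^ k
half< k q q< = m<n*o⇒m/o<n (subst (q <_) (*-comm 2 (2 ^ k)) q<)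

-- Descendant q, k + 1 levels below offset s, is child q % 2 of descendant q / 2, k levels below.
descendant≡child : ∀ l k s q →
  levelStart (l + suc k) + (s * 2 ^ suc k + q) ≡
  levelStart (suc (l + k)) + (2 * (s * 2 ^ k + q / 2) + q % 2)
descendant≡child l k s q = cong₂ _+_ (cong levelStart (+-suc l k))
  (trans (cong (s * 2 ^ suc k +_) (m≡m%n+[m/n]*n q 2)) (regroup s (2 ^ k) (q / 2) (q % 2)))
  where
  regroup : ∀ s p a e → s * (2 * p) + (e + a * 2) ≡ 2 * (s * p + a) + e
  regroup = solve-∀

module Walks (h : ℕ) where

  N : ℕ
  N = Graph.n (T h)

  -- Vacuously true when x or y is not a vertex index of T h.
  record Near (r x y : ℕ) : Set where
    constructor near
    field within-index : ∀ (u v : Fin N) → toℕ u ≡ x → toℕ v ≡ y → within (T h) r u v ≡ true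
  open Near public

  near-refl : ∀ x → Near 0 x x
  near-refl x = near λ u v u≡ v≡ →
    subst (λ u′ → within (T h) 0 u′ v ≡ true) (toℕ-injective (trans v≡ (sym u≡))) (within-refl (T h) 0 v)

  near-suc : ∀ {r x y} → Near r x y → Near (suc r) x y
  near-suc {r} (near xy) = near λ u v u≡ v≡ → within-suc (T h) {r} {u} {v} (xy u v u≡ v≡)

  near-mono : ∀ {r r′ x y} → r ≤ r′ → Near r x y → Near r′ x y
  near-mono r≤r′ xy with ≤⇒≤′ r≤r′
  ... | ≤′-refl       = xy
  ... | ≤′-step r≤′r″ = near-suc (near-mono (≤′⇒≤ r≤′r″) xy)

  near-step : ∀ {r x y z} → y < levelStart (suc h) → (childOf y z ∨ childOf z y) ≡ true →
    Near r x y → Near (suc r) x z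
  near-step {r} {y = y} {z} y< yz (near xy) = near λ u v u≡ v≡ →
    within-step (T h) {r} {u} {w} {v} (xy u w u≡ (toℕ-fromℕ< y<N))
      (subst₂ (λ a c → (childOf a c ∨ childOf c a) ≡ true) (sym (toℕ-fromℕ< y<N)) (sym v≡) yz)
    where
    y<N : y < N
    y<N = subst (y <_) (sym (∣T∣≡levelStart h)) y<
    w : Fin N
    w = fromℕ< y<N

  near-child : ∀ {r x y z} → y < levelStart (suc h) → childOf y z ≡ true →
    Near r x y → Near (suc r) x z
  near-child {y = y} {z} y< yz = near-step y< (cong (_∨ childOf z y) yz)

  near-parent : ∀ {r x y z} → z < levelStart (suc h) → childOf y z ≡ true →
    Near r x z → Near (suc r) x y
  near-parent {y = y} {z} z< yz = near-step z< (trans (cong (childOf z y ∨_) yz) (∨-zeroʳ (childOf z y)))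

  near-descendant : ∀ k {r x l s} → l + k ≤ h → s < 2 ^ l → Near r x (levelStart l + s) →
    ∀ q → q < 2 ^ k → Near (r + k) x (levelStart (l + k) + (s * 2 ^ k + q))
  near-descendant zero {r} {x} {l} {s} _ _ xv zero _ =
    subst₂ (λ r′ y → Near r′ x y) (sym (+-identityʳ r))
      (cong₂ _+_ (cong levelStart (sym (+-identityʳ l))) (sym (trans (+-identityʳ (s * 1)) (*-identityʳ s)))) xv
  near-descendant zero _ _ _ (suc q) (s≤s ())
  near-descendant (suc k) {r} {x} {l} {s} l+k<h s< xv q q< =
    subst₂ (λ r′ y → Near r′ x y) (sym (+-suc r k)) (sym (descendant≡child l k s q))
      (near-child (levelStart+offset< l+k≤h (descendantOffset< l k s (q / 2) s< (half< k q q<)))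
        (childOf-levelStart (l + k) (s * 2 ^ k + q / 2) (q % 2) (m%n<n q 2))
        (near-descendant k l+k≤h s< xv (q / 2) (half< k q q<)))
    where
    l+k≤h : l + k ≤ h
    l+k≤h = ≤-trans (+-monoʳ-≤ l (n≤1+n k)) l+k<h

  near-ancestor : ∀ k {r x l s} q → l + k ≤ h → s < 2 ^ l → q < 2 ^ k →
    Near r x (levelStart (l + k) + (s * 2 ^ k + q)) → Near (r + k) x (levelStart l + s)
  near-ancestor zero {r} {x} {l} {s} zero _ _ _ xv =
    subst₂ (λ r′ y → Near r′ x y) (sym (+-identityʳ r))
      (cong₂ _+_ (cong levelStart (+-identityʳ l)) (trans (+-identityʳ (s * 1)) (*-identityʳ s))) xv
  near-ancestor zero (suc q) _ _ (s≤s ()) _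
  near-ancestor (suc k) {r} {x} {l} {s} q l+k<h s< q< xv =
    subst (λ r′ → Near r′ x (levelStart l + s)) (sym (+-suc r k))
      (near-ancestor k (q / 2) l+k≤h s< (half< k q q<)
        (near-parent (subst (_< levelStart (suc h)) (descendant≡child l k s q)
                        (levelStart+offset< l+k<h (descendantOffset< l (suc k) s q s< q<)))
          (childOf-levelStart (l + k) (s * 2 ^ k + q / 2) (q % 2) (m%n<n q 2))
          (subst (Near r x) (descendant≡child l k s q) xv)))
    where
    l+k≤h : l + k ≤ h
    l+k≤h = ≤-trans (+-monoʳ-≤ l (n≤1+n k)) l+k<h

  near-via-ancestor : ∀ {a s k q j p} → a + k ≤ h → a + j ≤ h → s < 2 ^ a → q < 2 ^ k → p < 2 ^ j →
    Near (k + j) (levelStart (a + k) + (s * 2 ^ k + q)) (levelStart (a + j) + (s * 2 ^ j + p))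
  near-via-ancestor {a} {s} {k} {q} {j} a+k≤h a+j≤h s< q< p< =
    near-descendant j a+j≤h s< (near-ancestor k q a+k≤h s< q< (near-refl _)) _ p<

  ecc≤height+depth : ∀ (v : Fin N) {d s} → toℕ v ≡ levelStart d + s → s < 2 ^ d → d ≤ h →
    ecc (T h) v ≤ h + d
  ecc≤height+depth v {d} {s} v≡ s< d≤h = ecc≤ (T h) v (h + d) dist-u-v≤
    where
    dist-u-v≤ : ∀ u → dist (T h) u v ≤ h + d
    dist-u-v≤ u with position-of h (toℕ u) (subst (toℕ u <_) (∣T∣≡levelStart h) (toℕ<n u))
    ... | position l q l≤h q< u≡ = ≤-trans
      (dist≤ (T h) (within-index (near-via-ancestor {0} {0} {l} {q} {d} {s} l≤h d≤h (s≤s z≤n) q< s<) u v u≡ v≡))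
      (+-monoˡ-≤ d l≤h)

offset-split : ∀ {d j s} → j ≤ d → s < 2 ^ d →
  Σ ℕ λ s₀ → Σ ℕ λ s₁ → s₀ < 2 ^ (d ∸ j) × s₁ < 2 ^ j × s₀ * 2 ^ j + s₁ ≡ s
offset-split {d} {j} {s} j≤d s< =
  s / 2 ^ j , s % 2 ^ j ,
  m<n*o⇒m/o<n (subst (s <_) (trans (cong (2 ^_) (sym (m∸n+n≡m j≤d))) (^-distribˡ-+-* 2 (d ∸ j) j)) s<) ,
  m%n<n s (2 ^ j) ,
  trans (+-comm (s / 2 ^ j * 2 ^ j) (s % 2 ^ j)) (sym (m≡m%n+[m/n]*n s (2 ^ j)))
  where
  instance
    2^j≢0 : NonZero (2 ^ j)
    2^j≢0 = m^n≢0 2 j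

inRange : ℕ → ℕ → ℕ → Bool
inRange a l x = (a ≤ᵇ x) ∧ (x <ᵇ a + l)

inRange-intro : ∀ {a l x} → a ≤ x → x < a + l → inRange a l x ≡ true
inRange-intro a≤x x< = Equivalence.to T-≡ (Equivalence.from T-∧ (≤⇒≤ᵇ a≤x , <⇒<ᵇ x<))

inRange-elim : ∀ {a l x} → inRange a l x ≡ true → a ≤ x × x < a + l
inRange-elim {a} {l} {x} e with Equivalence.to T-∧ (Equivalence.from T-≡ e)
... | a≤ᵇx , x<ᵇ = ≤ᵇ⇒≤ a x a≤ᵇx , <ᵇ⇒< x (a + l) x<ᵇ

∨≡true⇒ : ∀ a {b} → (a ∨ b) ≡ true → a ≡ true ⊎ b ≡ true
∨≡true⇒ true  _ = inj₁ refl
∨≡true⇒ false e = inj₂ e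

module Balls (h : ℕ) (member : ℕ → Bool) where
  open Walks h public

  S : Subset N
  S = tabulate (member ∘ toℕ)

  Counted : ℕ → Fin N → ℕ → Set
  Counted r v x = member x ≡ true × Near r x (toℕ v)

  countFrom≤ballCount : ∀ r v (Q : ℕ → Bool) → (∀ x → Q x ≡ true → Counted r v x) →
    countFrom Q 0 (levelStart (suc h)) ≤ ballCount (T h) S r v
  countFrom≤ballCount r v Q Q⇒counted =
    subst (λ n → countFrom Q 0 n ≤ ballCount (T h) S r v) (∣T∣≡levelStart h)
      (countFrom≤countV (T h) _ Q λ i Qi → inBall i (Q⇒counted (toℕ i) Qi))
    where
    inBall : ∀ i → Counted r v (toℕ i) → (lookup S i ∧ within (T h) r i v) ≡ true
    inBall i (member-i , near-i) =
      cong₂ _∧_ (trans (lookup∘tabulate (member ∘ toℕ) i) member-i) (within-index near-i i v refl refl)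

  interval≤ballCount : ∀ {r v a l} → a + l ≤ levelStart (suc h) →
    (∀ x → a ≤ x → x < a + l → Counted r v x) → l ≤ ballCount (T h) S r v
  interval≤ballCount {r} {v} {a} {l} a+l≤ counted = begin
    l                                              ≤⟨ countFrom-all (inRange a l) a l (λ _ → inRange-intro) ⟩
    countFrom (inRange a l) a l                    ≤⟨ sumFrom-⊆ _ a l a+l≤ ⟩
    countFrom (inRange a l) 0 (levelStart (suc h)) ≤⟨ countFrom≤ballCount r v _ counted′ ⟩
    ballCount (T h) S r v                          ∎
    where
    open ≤-Reasoning
    counted′ : ∀ x → inRange a l x ≡ true → Counted r v x
    counted′ x e = let a≤x , x< = inRange-elim e in counted x a≤x x<

  intervals≤ballCount : ∀ {r v a₁ l₁ a₂ l₂} → a₁ + l₁ ≤ a₂ → a₂ + l₂ ≤ levelStart (suc h) →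
    (∀ x → a₁ ≤ x → x < a₁ + l₁ → Counted r v x) → (∀ x → a₂ ≤ x → x < a₂ + l₂ → Counted r v x) →
    l₁ + l₂ ≤ ballCount (T h) S r v
  intervals≤ballCount {r} {v} {a₁} {l₁} {a₂} {l₂} before after counted₁ counted₂ = begin
    l₁ + l₂                               ≤⟨ +-mono-≤ (countFrom-all Q a₁ l₁ (λ _ p q → Q₁ p q))
                                                      (countFrom-all Q a₂ l₂ (λ _ p q → Q₂ p q)) ⟩
    countFrom Q a₁ l₁ + countFrom Q a₂ l₂ ≤⟨ sumFrom-disjoint (⟦_⟧ ∘ Q) a₁ l₁ a₂ l₂ before after ⟩
    countFrom Q 0 (levelStart (suc h))    ≤⟨ countFrom≤ballCount r v Q counted ⟩
    ballCount (T h) S r v                 ∎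
    where
    open ≤-Reasoning
    Q : ℕ → Bool
    Q x = inRange a₁ l₁ x ∨ inRange a₂ l₂ x
    Q₁ : ∀ {x} → a₁ ≤ x → x < a₁ + l₁ → Q x ≡ true
    Q₁ {x} p q = cong (_∨ inRange a₂ l₂ x) (inRange-intro p q)
    Q₂ : ∀ {x} → a₂ ≤ x → x < a₂ + l₂ → Q x ≡ true
    Q₂ {x} p q = trans (cong (inRange a₁ l₁ x ∨_) (inRange-intro p q)) (∨-zeroʳ _)
    counted : ∀ x → Q x ≡ true → Counted r v x
    counted x e with ∨≡true⇒ (inRange a₁ l₁ x) e
    ... | inj₁ e₁ = let p , q = inRange-elim e₁ in counted₁ x p q
    ... | inj₂ e₂ = let p , q = inRange-elim e₂ in counted₂ x p q

  record CountedBlock (r : ℕ) (v : Fin N) (L k : ℕ) : Set where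
    field
      start   : ℕ
      start≥  : levelStart L ≤ start
      end≤    : start + 2 ^ k ≤ levelStart (suc L)
      counted : ∀ x → start ≤ x → x < start + 2 ^ k → Counted r v x

  -- v lies j levels below the vertex (a, s₀); the block consists of the 2 ^ k
  -- descendants of (a, s₀) that lie k levels below it.
  descendant-block : ∀ {r v a s₀ s₁ j k} → toℕ v ≡ levelStart (a + j) + (s₀ * 2 ^ j + s₁) →
    a + j ≤ h → a + k ≤ h → s₀ < 2 ^ a → s₁ < 2 ^ j →
    (∀ q → q < 2 ^ (a + k) → member (levelStart (a + k) + q) ≡ true) → k + j ≤ r →
    CountedBlock r v (a + k) k
  descendant-block {r} {v} {a} {s₀} {s₁} {j} {k} v≡ a+j≤h a+k≤h s₀< s₁< level⊆S k+j≤r = record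
    { start   = levelStart (a + k) + s₀ * 2 ^ k
    ; start≥  = m≤m+n _ _
    ; end≤    = end≤
    ; counted = counted
    }
    where
    L = a + k
    end≤ : levelStart L + s₀ * 2 ^ k + 2 ^ k ≤ levelStart (suc L)
    end≤ = subst₂ _≤_ (sym (+-assoc (levelStart L) _ _)) (sym (levelStart-suc L))
                      (+-monoʳ-≤ (levelStart L) (descendantBlock≤ a k s₀ s₀<))
    counted : ∀ x → levelStart L + s₀ * 2 ^ k ≤ x → x < levelStart L + s₀ * 2 ^ k + 2 ^ k → Counted r v x
    counted x start≤x x<end = member-x , near-x
      where
      q = x ∸ (levelStart L + s₀ * 2 ^ k)
      x≡ : x ≡ levelStart L + (s₀ * 2 ^ k + q)
      x≡ = trans (sym (m+[n∸m]≡n start≤x)) (+-assoc (levelStart L) _ _)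
      q< : q < 2 ^ k
      q< = +-cancelˡ-< (levelStart L + s₀ * 2 ^ k) _ _ (subst (_< _) (sym (m+[n∸m]≡n start≤x)) x<end)
      member-x : member x ≡ true
      member-x = trans (cong member x≡) (level⊆S _ (descendantOffset< a k s₀ q s₀< q<))
      near-x : Near r x (toℕ v)
      near-x = subst₂ (Near r) (sym x≡) (sym v≡)
        (near-mono k+j≤r (near-via-ancestor {a} {s₀} {k} {q} {j} {s₁} a+k≤h a+j≤h s₀< q< s₁<))

  block≤ballCount : ∀ {r v L k} → CountedBlock r v L k → L ≤ h → 2 ^ k ≤ ballCount (T h) S r v
  block≤ballCount B L≤h = interval≤ballCount (≤-trans end≤ (levelStart-mono-≤ (s≤s L≤h))) counted
    where open CountedBlock B

  blocks≤ballCount : ∀ {r v L₁ k₁ L₂ k₂} → CountedBlock r v L₁ k₁ → CountedBlock r v L₂ k₂ →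
    L₁ < L₂ → L₂ ≤ h → 2 ^ k₁ + 2 ^ k₂ ≤ ballCount (T h) S r v
  blocks≤ballCount B₁ B₂ L₁<L₂ L₂≤h = intervals≤ballCount
    (≤-trans (CountedBlock.end≤ B₁) (≤-trans (levelStart-mono-≤ L₁<L₂) (CountedBlock.start≥ B₂)))
    (≤-trans (CountedBlock.end≤ B₂) (levelStart-mono-≤ (s≤s L₂≤h)))
    (CountedBlock.counted B₁) (CountedBlock.counted B₂)

  ancestor-block : ∀ {r v d s} → toℕ v ≡ levelStart d + s → s < 2 ^ d → d ≤ h →
    ∀ j k L → j ≤ d → L + j ≡ d + k → L ≤ h →
    (∀ q → q < 2 ^ L → member (levelStart L + q) ≡ true) → j + k ≤ r → CountedBlock r v L k
  ancestor-block {r} {v} {d} {s} v≡ s< d≤h j k L j≤d L+j≡ L≤h level⊆S j+k≤r with offset-split j≤d s<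
  ... | s₀ , s₁ , s₀< , s₁< , s≡ =
    subst (λ L′ → CountedBlock r v L′ k) a+k≡L
      (descendant-block {a = a} v≡′ (subst (_≤ h) (sym a+j≡d) d≤h) (subst (_≤ h) (sym a+k≡L) L≤h) s₀< s₁<
        (subst (λ L′ → ∀ q → q < 2 ^ L′ → member (levelStart L′ + q) ≡ true) (sym a+k≡L) level⊆S)
        (subst (_≤ r) (+-comm j k) j+k≤r))
    where
    a = d ∸ j
    a+j≡d : a + j ≡ d
    a+j≡d = m∸n+n≡m j≤d
    a+k≡L : a + k ≡ L
    a+k≡L = +-cancelʳ-≡ j (a + k) L (begin
      a + k + j  ≡⟨ +-swapʳ a k j ⟩
      a + j + k  ≡⟨ cong (_+ k) a+j≡d ⟩
      d + k      ≡⟨ L+j≡ ⟨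
      L + j      ∎)
      where
      open ≡-Reasoning
      +-swapʳ : ∀ a k j → a + k + j ≡ a + j + k
      +-swapʳ = solve-∀
    v≡′ : toℕ v ≡ levelStart (a + j) + (s₀ * 2 ^ j + s₁)
    v≡′ = trans v≡ (sym (cong₂ (λ l o → levelStart l + o) a+j≡d s≡))

m+k≡n⇒m≤n : ∀ {m n} k → m + k ≡ n → m ≤ n
m+k≡n⇒m≤n k refl = m≤m+n _ k

n<2^n : ∀ n → n < 2 ^ n
n<2^n zero    = s≤s z≤n
n<2^n (suc n) = +-mono-≤ (≤-trans (s≤s z≤n) (n<2^n n)) (≤-trans (n<2^n n) (m≤m+n (2 ^ n) 0))

3+n+n≤2^n+2^[1+n] : ∀ n → 3 + (n + n) ≤ 2 ^ n + 2 ^ suc n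
3+n+n≤2^n+2^[1+n] n = begin
  3 + (n + n)         ≤⟨ m+k≡n⇒m≤n n (solve (n ∷ [])) ⟩
  3 * suc n           ≤⟨ *-monoʳ-≤ 3 (n<2^n n) ⟩
  3 * 2 ^ n           ≡⟨ triple (2 ^ n) ⟩
  2 ^ n + 2 ^ suc n   ∎
  where
  open ≤-Reasoning
  triple : ∀ p → 3 * p ≡ p + 2 * p
  triple = solve-∀

4+n+n≤2^[1+n]+2^[1+n] : ∀ n → 4 + (n + n) ≤ 2 ^ suc n + 2 ^ suc n
4+n+n≤2^[1+n]+2^[1+n] n = begin
  4 + (n + n)             ≤⟨ m+k≡n⇒m≤n (2 * n) (solve (n ∷ [])) ⟩
  4 * suc n               ≤⟨ *-monoʳ-≤ 4 (n<2^n n) ⟩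
  4 * 2 ^ n               ≡⟨ quadruple (2 ^ n) ⟩
  2 ^ suc n + 2 ^ suc n   ∎
  where
  open ≤-Reasoning
  quadruple : ∀ p → 4 * p ≡ 2 * p + 2 * p
  quadruple = solve-∀

4+n+n≤2^n+2^[1+n] : ∀ n → 1 ≤ n → 4 + (n + n) ≤ 2 ^ n + 2 ^ suc n
4+n+n≤2^n+2^[1+n] (suc n) _ = begin
  4 + (suc n + suc n)       ≤⟨ m+k≡n⇒m≤n n (solve (n ∷ [])) ⟩
  3 * suc (suc n)           ≤⟨ *-monoʳ-≤ 3 (n<2^n (suc n)) ⟩
  3 * 2 ^ suc n             ≡⟨ triple (2 ^ suc n) ⟩
  2 ^ suc n + 2 ^ suc (suc n) ∎
  where
  open ≤-Reasoning
  triple : ∀ p → 3 * p ≡ p + 2 * p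
  triple = solve-∀

4+n≤2^[2+n] : ∀ n → 4 + n ≤ 2 ^ (2 + n)
4+n≤2^[2+n] n = begin
  4 + n           ≤⟨ m+k≡n⇒m≤n (3 * n) (solve (n ∷ [])) ⟩
  4 * suc n       ≤⟨ *-monoʳ-≤ 4 (n<2^n n) ⟩
  4 * 2 ^ n       ≡⟨ quadruple (2 ^ n) ⟩
  2 ^ (2 + n)     ∎
  where
  open ≤-Reasoning
  quadruple : ∀ p → 4 * p ≡ 2 * (2 * p)
  quadruple = solve-∀

record AdmissibleLevels (h : ℕ) (SL : ℕ → Bool) : Set where
  field
    root∈   : SL 0 ≡ true
    h∸1∈    : ∀ l → suc l ≡ h → SL l ≡ true
    h∸2∈    : ∀ l → suc (suc l) ≡ h → SL l ≡ true
    window∈ : ∀ l → l + 3 ≤ h → SL l ≡ true ⊎ SL (suc l) ≡ true ⊎ SL (suc (suc l)) ≡ true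
open AdmissibleLevels

-- X counts S ∩ N_r[v] for a vertex v of depth d; a level L ∈ SL contributes the 2 ^ k
-- descendants on level L of the ancestor j levels above v.
record BallBounds (X h d r : ℕ) (SL : ℕ → Bool) : Set where
  field
    block     : ∀ j k L → j ≤ d → L + j ≡ d + k → L ≤ h → SL L ≡ true → j + k ≤ r → 2 ^ k ≤ X
    blocks    : ∀ j₁ k₁ L₁ j₂ k₂ L₂ →
                j₁ ≤ d → L₁ + j₁ ≡ d + k₁ → SL L₁ ≡ true → j₁ + k₁ ≤ r →
                j₂ ≤ d → L₂ + j₂ ≡ d + k₂ → L₂ ≤ h → SL L₂ ≡ true → j₂ + k₂ ≤ r →
                L₁ < L₂ → 2 ^ k₁ + 2 ^ k₂ ≤ X
    root-pair : d ≡ 0 → r ≡ 2 → SL 1 ≡ false → SL 2 ≡ false → 2 ≤ X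
open BallBounds

1≤suc : ∀ {n} → 1 ≤ suc n
1≤suc = s≤s z≤n

ball-shallow-1 : ∀ {X} d w {SL} → AdmissibleLevels (d + 1 + 2 + w) SL →
  BallBounds X (d + 1 + 2 + w) d 1 SL → 1 ≤ X
ball-shallow-1 zero w A B = block B 0 0 0 z≤n refl z≤n (root∈ A) z≤n
ball-shallow-1 (suc d) w A B with window∈ A d (m+k≡n⇒m≤n (1 + w) (solve (d ∷ w ∷ [])))
... | inj₁ e =
  block B 1 0 d 1≤suc (solve (d ∷ [])) (m+k≡n⇒m≤n (4 + w) (solve (d ∷ w ∷ []))) e ≤-refl
... | inj₂ (inj₁ e) =
  block B 0 0 (suc d) z≤n refl (m+k≡n⇒m≤n (3 + w) (solve (d ∷ w ∷ []))) e z≤n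
... | inj₂ (inj₂ e) = ≤-trans 1≤suc
  (block B 0 1 (suc (suc d)) z≤n (solve (d ∷ [])) (m+k≡n⇒m≤n (2 + w) (solve (d ∷ w ∷ []))) e ≤-refl)

ball-shallow-2 : ∀ {X} d w {SL} → AdmissibleLevels (d + 2 + 2 + w) SL →
  BallBounds X (d + 2 + 2 + w) d 2 SL → 2 ≤ X
ball-shallow-2 d w {SL} A B with window∈ A d (m+k≡n⇒m≤n (1 + w) (solve (d ∷ w ∷ [])))
... | inj₂ (inj₁ e) =
  block B 0 1 (suc d) z≤n (solve (d ∷ [])) (m+k≡n⇒m≤n (3 + w) (solve (d ∷ w ∷ []))) e 1≤suc
... | inj₂ (inj₂ e) = ≤-trans (s≤s 1≤suc)
  (block B 0 2 (suc (suc d)) z≤n (solve (d ∷ [])) (m+k≡n⇒m≤n (2 + w) (solve (d ∷ w ∷ []))) e ≤-refl)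
ball-shallow-2 (suc d) w A B | inj₁ e =
  block B 1 1 (suc d) 1≤suc refl (m+k≡n⇒m≤n (4 + w) (solve (d ∷ w ∷ []))) e ≤-refl
ball-shallow-2 zero w {SL} A B | inj₁ _ with SL 1 in SL1 | SL 2 in SL2
... | true  | _    = block B 0 1 1 z≤n refl (m+k≡n⇒m≤n (3 + w) (solve (w ∷ []))) SL1 1≤suc
... | false | true = ≤-trans (s≤s 1≤suc) (block B 0 2 2 z≤n refl (m+k≡n⇒m≤n (2 + w) (solve (w ∷ []))) SL2 ≤-refl)
... | false | false = root-pair B refl refl SL1 SL2

ball-shallow-3 : ∀ {X} d w {SL} → AdmissibleLevels (d + 3 + 2 + w) SL →
  BallBounds X (d + 3 + 2 + w) d 3 SL → 3 ≤ X
ball-shallow-3 d w A B with window∈ A (suc d) (m+k≡n⇒m≤n (1 + w) (solve (d ∷ w ∷ [])))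
... | inj₂ (inj₁ e) = ≤-trans (s≤s (s≤s 1≤suc))
  (block B 0 2 (suc (suc d)) z≤n (solve (d ∷ [])) (m+k≡n⇒m≤n (3 + w) (solve (d ∷ w ∷ []))) e (s≤s 1≤suc))
... | inj₂ (inj₂ e) = ≤-trans (s≤s (s≤s 1≤suc))
  (block B 0 3 (suc (suc (suc d))) z≤n (solve (d ∷ [])) (m+k≡n⇒m≤n (2 + w) (solve (d ∷ w ∷ []))) e ≤-refl)
ball-shallow-3 (suc d) w A B | inj₁ e = ≤-trans (s≤s (s≤s 1≤suc))
  (block B 1 2 (suc (suc d)) 1≤suc (solve (d ∷ [])) (m+k≡n⇒m≤n (4 + w) (solve (d ∷ w ∷ []))) e ≤-refl)
ball-shallow-3 zero w A B | inj₁ e =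
  blocks B 0 0 0 0 1 1 z≤n refl (root∈ A) z≤n z≤n refl (m+k≡n⇒m≤n (4 + w) (solve (w ∷ []))) e 1≤suc 1≤suc

-- For r ≥ 4 one of the levels d + r - 2, d + r - 1, d + r lies in SL, and 2 ^ (r - 2) ≥ r.
ball-shallow-4+ : ∀ {X} d w r {SL} → AdmissibleLevels (d + (4 + r) + 2 + w) SL →
  BallBounds X (d + (4 + r) + 2 + w) d (4 + r) SL → 4 + r ≤ X
ball-shallow-4+ d w r A B with window∈ A (d + 2 + r) (m+k≡n⇒m≤n (1 + w) (solve (d ∷ r ∷ w ∷ [])))
... | inj₁ e = ≤-trans (4+n≤2^[2+n] r)
  (block B 0 (2 + r) (d + 2 + r) z≤n (solve (d ∷ r ∷ [])) (m+k≡n⇒m≤n (4 + w) (solve (d ∷ r ∷ w ∷ []))) e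
    (m+k≡n⇒m≤n 2 (solve (r ∷ []))))
... | inj₂ (inj₁ e) = ≤-trans (4+n≤2^[2+n] r) (≤-trans (^-monoʳ-≤ 2 (n≤1+n (2 + r)))
  (block B 0 (3 + r) (suc (d + 2 + r)) z≤n (solve (d ∷ r ∷ [])) (m+k≡n⇒m≤n (3 + w) (solve (d ∷ r ∷ w ∷ []))) e
    (m+k≡n⇒m≤n 1 (solve (r ∷ [])))))
... | inj₂ (inj₂ e) = ≤-trans (4+n≤2^[2+n] r) (≤-trans (^-monoʳ-≤ 2 (m+k≡n⇒m≤n {2 + r} {4 + r} 2 (solve (r ∷ []))))
  (block B 0 (4 + r) (suc (suc (d + 2 + r))) z≤n (solve (d ∷ r ∷ [])) (m+k≡n⇒m≤n (2 + w) (solve (d ∷ r ∷ w ∷ []))) e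
    ≤-refl))

ball-shallow : ∀ {X} d r w {SL} → AdmissibleLevels (d + r + 2 + w) SL →
  BallBounds X (d + r + 2 + w) d r SL → 1 ≤ r → r ≤ X
ball-shallow d 0                         w A B ()
ball-shallow d 1                         w A B _ = ball-shallow-1 d w A B
ball-shallow d 2                         w A B _ = ball-shallow-2 d w A B
ball-shallow d 3                         w A B _ = ball-shallow-3 d w A B
ball-shallow d (suc (suc (suc (suc r)))) w A B _ = ball-shallow-4+ d w r A B

even-or-odd : ∀ x → Σ ℕ λ i → x ≡ i + i ⊎ x ≡ suc (i + i)
even-or-odd zero    = 0 , inj₁ refl
even-or-odd (suc x) with even-or-odd x
... | i , inj₁ x≡ = i , inj₂ (cong suc x≡)
... | i , inj₂ x≡ = suc i , inj₁ (trans (cong suc x≡) (cong suc (sym (+-suc i i))))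

halve : ∀ x → Σ ℕ λ q → q + q ≤ x × x ≤ suc (q + q)
halve x with even-or-odd x
... | q , inj₁ x≡ = q , ≤-reflexive (sym x≡) , ≤-trans (≤-reflexive x≡) (n≤1+n _)
... | q , inj₂ x≡ = q , ≤-trans (n≤1+n _) (≤-reflexive (sym x≡)) , ≤-reflexive x≡

halve-above : ∀ {e r} → e ≤ r → Σ ℕ λ q → e + (q + q) ≤ r × r ≤ suc (e + (q + q))
halve-above {e} {r} e≤r with halve (r ∸ e)
... | q , lower , upper =
  q , subst (e + (q + q) ≤_) r≡ (+-monoʳ-≤ e lower) ,
      subst (_≤ suc (e + (q + q))) r≡ (≤-trans (+-monoʳ-≤ e upper) (≤-reflexive (+-suc e (q + q))))
  where
  r≡ : e + (r ∸ e) ≡ r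
  r≡ = m+[n∸m]≡n e≤r

i+i≤1+n+n⇒i≤n : ∀ i n → i + i ≤ suc (n + n) → i ≤ n
i+i≤1+n+n⇒i≤n zero    n       _ = z≤n
i+i≤1+n+n⇒i≤n (suc i) zero    (s≤s i+1+i≤0) with () ← subst (_≤ 0) (+-suc i i) i+1+i≤0
i+i≤1+n+n⇒i≤n (suc i) (suc n) (s≤s le) =
  s≤s (i+i≤1+n+n⇒i≤n i n (≤-pred (subst₂ _≤_ (+-suc i i) (cong suc (+-suc n n)) le)))

bottom-blocks : ∀ {X hh d r SL} → AdmissibleLevels (suc (suc hh)) SL →
  BallBounds X (suc (suc hh)) d r SL → ∀ j₁ k₁ j₂ k₂ →
  j₁ ≤ d → hh + j₁ ≡ d + k₁ → j₁ + k₁ ≤ r →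
  j₂ ≤ d → suc hh + j₂ ≡ d + k₂ → j₂ + k₂ ≤ r → 2 ^ k₁ + 2 ^ k₂ ≤ X
bottom-blocks {hh = hh} A B j₁ k₁ j₂ k₂ j₁≤d eq₁ reach₁ j₂≤d eq₂ reach₂ =
  blocks B j₁ k₁ hh j₂ k₂ (suc hh) j₁≤d eq₁ (h∸2∈ A hh refl) reach₁
    j₂≤d eq₂ (n≤1+n _) (h∸1∈ A (suc hh) refl) reach₂ ≤-refl

2+n+[2+n]≡4+[n+n] : ∀ n → suc (suc n) + suc (suc n) ≡ 4 + (n + n)
2+n+[2+n]≡4+[n+n] = solve-∀

ball-leaf : ∀ {X} hh r {SL} → 1 ≤ hh → AdmissibleLevels (suc (suc hh)) SL →
  BallBounds X (suc (suc hh)) (suc (suc hh)) r SL → r ≤ suc (suc hh) + suc (suc hh) → r ≤ X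
ball-leaf hh 0 _ _ _ _ = z≤n
ball-leaf hh 1 _ A B _ =
  block B 1 0 (suc hh) 1≤suc (solve (hh ∷ [])) (n≤1+n _) (h∸1∈ A (suc hh) refl) ≤-refl
ball-leaf hh 2 _ A B _ =
  bottom-blocks A B 2 0 1 0 (s≤s 1≤suc) (solve (hh ∷ [])) ≤-refl 1≤suc (solve (hh ∷ [])) 1≤suc
ball-leaf hh (suc (suc (suc x))) 1≤hh A B r≤ with even-or-odd x
... | i , inj₁ refl = ≤-trans (3+n+n≤2^n+2^[1+n] i)
  (bottom-blocks A B (2 + i) i (2 + i) (suc i)
    (s≤s (s≤s i≤hh)) (solve (hh ∷ i ∷ [])) (m+k≡n⇒m≤n 1 (solve (i ∷ [])))
    (s≤s (s≤s i≤hh)) (solve (hh ∷ i ∷ [])) (≤-reflexive (solve (i ∷ []))))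
  where
  i≤hh : i ≤ hh
  i≤hh = i+i≤1+n+n⇒i≤n i hh (≤-pred (≤-pred (≤-pred (subst (3 + (i + i) ≤_) (2+n+[2+n]≡4+[n+n] hh) r≤))))
... | i , inj₂ refl with i <? hh
...   | yes i<hh = ≤-trans (4+n+n≤2^[1+n]+2^[1+n] i)
  (bottom-blocks A B (3 + i) (suc i) (2 + i) (suc i)
    (s≤s (s≤s i<hh)) (solve (hh ∷ i ∷ [])) (≤-reflexive (solve (i ∷ [])))
    (s≤s (s≤s (<⇒≤ i<hh))) (solve (hh ∷ i ∷ [])) (m+k≡n⇒m≤n 1 (solve (i ∷ []))))
...   | no  i≮hh with ≤-antisym i≤hh (≮⇒≥ i≮hh)
  where
  i≤hh : i ≤ hh
  i≤hh = i+i≤1+n+n⇒i≤n i hh (≤-trans (≤-pred (≤-pred (≤-pred (≤-pred (subst (4 + (i + i) ≤_) (2+n+[2+n]≡4+[n+n] hh) r≤))))) (n≤1+n _))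
...     | refl = ≤-trans (4+n+n≤2^n+2^[1+n] i 1≤hh)
  (bottom-blocks A B (2 + i) i (2 + i) (suc i)
    ≤-refl (solve (i ∷ [])) (m+k≡n⇒m≤n 2 (solve (i ∷ [])))
    ≤-refl (solve (i ∷ [])) (m+k≡n⇒m≤n 1 (solve (i ∷ []))))

-- Writing e = h - 1 - d and r ∈ {e + 2q, e + 2q + 1}, the ancestor q levels above the
-- vertex (or the root, if q ≥ d) sees both bottom blocks within distance r.
ball-internal : ∀ {X} hh d e q r {SL} → 1 ≤ hh → d + e ≡ suc hh → AdmissibleLevels (suc (suc hh)) SL →
  BallBounds X (suc (suc hh)) d r SL → r ≤ suc (suc hh) + d → e + (q + q) ≤ r → r ≤ suc (e + (q + q)) →
  r ≤ X
ball-internal hh d e q r 1≤hh d+e≡ A B r≤ lower upper with d ≤? q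
... | yes d≤q = ≤-trans r≤4+hh+hh (≤-trans (4+n+n≤2^n+2^[1+n] hh 1≤hh)
  (bottom-blocks A B d hh d (suc hh) ≤-refl (+-comm hh d) (≤-trans (+-monoʳ-≤ d (n≤1+n hh)) reach)
                                    ≤-refl (+-comm (suc hh) d) reach))
  where
  reach : d + suc hh ≤ r
  reach = begin
    d + suc hh   ≡⟨ cong (d +_) d+e≡ ⟨
    d + (d + e)  ≡⟨ solve (d ∷ e ∷ []) ⟩
    e + (d + d)  ≤⟨ +-monoʳ-≤ e (+-mono-≤ d≤q d≤q) ⟩
    e + (q + q)  ≤⟨ lower ⟩
    r            ∎
    where open ≤-Reasoning
  r≤4+hh+hh : r ≤ 4 + (hh + hh)
  r≤4+hh+hh = ≤-trans r≤ (≤-trans (+-monoʳ-≤ (suc (suc hh)) (≤-trans (m+k≡n⇒m≤n e d+e≡) (n≤1+n _)))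
                                   (≤-reflexive (2+n+[2+n]≡4+[n+n] hh)))
... | no d≰q with e + q in e+q≡
...   | zero = ≤-trans upper′
  (block B 0 0 d z≤n refl (≤-trans (m+k≡n⇒m≤n e d+e≡) (n≤1+n _)) (h∸1∈ A d (cong suc d≡)) z≤n)
  where
  e≡0 : e ≡ 0
  e≡0 = m+n≡0⇒m≡0 e e+q≡
  q≡0 : q ≡ 0
  q≡0 = m+n≡0⇒n≡0 e e+q≡
  upper′ : r ≤ 1
  upper′ = subst (λ z → r ≤ suc z) (cong₂ (λ e q → e + (q + q)) e≡0 q≡0) upper
  d≡ : d ≡ suc hh
  d≡ = trans (sym (+-identityʳ d)) (trans (cong (d +_) (sym e≡0)) d+e≡)
...   | suc y = ≤-trans count
  (bottom-blocks A B q y q (suc y) (<⇒≤ q<d) (suc-injective (trans hh+q≡ (+-suc d y))) reach₁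
                                   (<⇒≤ q<d) hh+q≡ reach₂)
  where
  q<d : q < d
  q<d = ≰⇒> d≰q
  hh+q≡ : suc hh + q ≡ d + suc y
  hh+q≡ = begin
    suc hh + q    ≡⟨ cong (_+ q) d+e≡ ⟨
    d + e + q     ≡⟨ +-assoc d e q ⟩
    d + (e + q)   ≡⟨ cong (d +_) e+q≡ ⟩
    d + suc y     ∎
    where open ≡-Reasoning
  reach₂ : q + suc y ≤ r
  reach₂ = begin
    q + suc y     ≡⟨ cong (q +_) e+q≡ ⟨
    q + (e + q)   ≡⟨ solve (q ∷ e ∷ []) ⟩
    e + (q + q)   ≤⟨ lower ⟩
    r             ∎
    where open ≤-Reasoning
  reach₁ : q + y ≤ r
  reach₁ = ≤-trans (+-monoʳ-≤ q (n≤1+n y)) reach₂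
  count : r ≤ 2 ^ y + 2 ^ suc y
  count = begin
    r                          ≤⟨ upper ⟩
    suc (e + (q + q))          ≤⟨ s≤s (m+k≡n⇒m≤n e (solve (e ∷ q ∷ []))) ⟩
    suc ((e + q) + (e + q))    ≡⟨ cong (λ z → suc (z + z)) e+q≡ ⟩
    suc (suc y + suc y)        ≡⟨ cong suc (+-suc (suc y) y) ⟩
    3 + (y + y)                ≤⟨ 3+n+n≤2^n+2^[1+n] y ⟩
    2 ^ y + 2 ^ suc y          ∎
    where open ≤-Reasoning

ball-deep : ∀ {X} h d r {SL} → 4 ≤ h → d ≤ h → r ≤ h + d → h ≤ suc (d + r) →
  AdmissibleLevels h SL → BallBounds X h d r SL → r ≤ X
ball-deep {X} (suc (suc hh)) d r (s≤s (s≤s 2≤hh)) d≤h r≤ h≤ A B with m≤n⇒m<n∨m≡n d≤h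
... | inj₂ refl       = ball-leaf hh r (≤-trans 1≤suc 2≤hh) A B r≤
... | inj₁ (s≤s d≤1+hh) = internal (halve-above e≤r)
  where
  e = suc hh ∸ d
  d+e≡ : d + e ≡ suc hh
  d+e≡ = m+[n∸m]≡n d≤1+hh
  e≤r : e ≤ r
  e≤r = +-cancelˡ-≤ d e r (subst (_≤ d + r) (sym d+e≡) (≤-pred h≤))
  internal : (Σ ℕ λ q → e + (q + q) ≤ r × r ≤ suc (e + (q + q))) → r ≤ X
  internal (q , lower , upper) = ball-internal hh d e q r (≤-trans 1≤suc 2≤hh) d+e≡ A B r≤ lower upper

ball≥radius : ∀ {X} h d r {SL} → 4 ≤ h → d ≤ h → 1 ≤ r → r ≤ h + d →
  AdmissibleLevels h SL → BallBounds X h d r SL → r ≤ X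
ball≥radius h d r 4≤h d≤h 1≤r r≤ A B with suc (suc (d + r)) ≤? h
... | no  h≤  = ball-deep h d r 4≤h d≤h r≤ (≤-pred (≰⇒> h≤)) A B
... | yes d+r+2≤h with m≤n⇒∃[o]m+o≡n (subst (_≤ h) (+-comm 2 (d + r)) d+r+2≤h)
...   | w , refl = ball-shallow d r w A B 1≤r

-- atDepth P fuel l x = P L for the depth L ≥ l of the heap index x (given enough fuel).
atDepth : (ℕ → Bool) → ℕ → ℕ → ℕ → Bool
atDepth P zero       l x = false
atDepth P (suc fuel) l x = if x <ᵇ levelStart (suc l) then P l else atDepth P fuel (suc l) x

atDepth-level : ∀ P fuel {l L x} → l ≤ L → L < l + fuel → levelStart L ≤ x → x < levelStart (suc L) →
  atDepth P fuel l x ≡ P L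
atDepth-level P zero {l} {L} l≤L L< _ _ = ⊥-elim (<-irrefl refl (≤-trans (subst (L <_) (+-identityʳ l) L<) l≤L))
atDepth-level P (suc fuel) {l} {L} {x} l≤L L< start≤x x<end with x <ᵇ levelStart (suc l) in x<ᵇ | m≤n⇒m<n∨m≡n l≤L
... | true  | inj₂ refl = refl
... | true  | inj₁ l<L = ⊥-elim (<-irrefl refl
  (≤-trans (<ᵇ⇒< x (levelStart (suc l)) (Equivalence.from T-≡ x<ᵇ)) (≤-trans (levelStart-mono-≤ l<L) start≤x)))
... | false | inj₁ l<L = atDepth-level P fuel l<L (subst (L <_) (+-suc l fuel) L<) start≤x x<end
... | false | inj₂ refl with () ← trans (sym x<ᵇ) (Equivalence.to T-≡ (<⇒<ᵇ x<end))

periodic : ℕ → ℕ → ℕ → Bool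
periodic t zero    l = false
periodic t (suc m) l = periodic t m l ∨ (l ≡ᵇ t + 1 + 3 * m)

periodic-hit : ∀ t m i → i < m → periodic t m (t + 1 + 3 * i) ≡ true
periodic-hit t (suc m) i (s≤s i≤m) with m≤n⇒m<n∨m≡n i≤m
... | inj₁ i<m rewrite periodic-hit t m i i<m = refl
... | inj₂ refl = trans (cong (periodic t m (t + 1 + 3 * i) ∨_) (≡⇒≡ᵇ-true {t + 1 + 3 * i} refl)) (∨-zeroʳ _)

periodic-near : ∀ t m l → t ≤ suc l → l + 3 ≤ 3 * m + t →
  Σ ℕ λ i → i < m × Σ ℕ λ ρ → ρ < 3 × t + 1 + 3 * i + ρ ≡ suc (suc l)
periodic-near t m l t≤ l+3≤ = i , i<m , ρ , m%n<n y 3 , hit≡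
  where
  y = suc l ∸ t
  i = y / 3
  ρ = y % 3
  hit≡ : t + 1 + 3 * i + ρ ≡ suc (suc l)
  hit≡ = begin
    t + 1 + 3 * i + ρ  ≡⟨ regroup t i ρ ⟩
    suc (ρ + i * 3 + t) ≡⟨ cong (λ z → suc (z + t)) (m≡m%n+[m/n]*n y 3) ⟨
    suc (y + t)        ≡⟨ cong suc (m∸n+n≡m t≤) ⟩
    suc (suc l)        ∎
    where
    open ≡-Reasoning
    regroup : ∀ t i ρ → t + 1 + 3 * i + ρ ≡ suc (ρ + i * 3 + t)
    regroup = solve-∀
  i<m : i < m
  i<m = *-cancelˡ-< 3 i m (+-cancelʳ-< t (3 * i) (3 * m) (begin-strict
    3 * i + t          <⟨ m+k≡n⇒m≤n ρ (shuffle t i ρ) ⟩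
    t + 1 + 3 * i + ρ  ≡⟨ hit≡ ⟩
    suc (suc l)        <⟨ m+k≡n⇒m≤n 0 (solve (l ∷ [])) ⟩
    l + 3              ≤⟨ l+3≤ ⟩
    3 * m + t          ∎))
    where
    open ≤-Reasoning
    shuffle : ∀ t i ρ → suc (3 * i + t) + ρ ≡ t + 1 + 3 * i + ρ
    shuffle = solve-∀

periodicSum : ℕ → ℕ → ℕ
periodicSum t zero    = 0
periodicSum t (suc m) = periodicSum t m + 2 ^ (t + 1 + 3 * m)

sumFrom-periodic≤ : ∀ t m o n → sumFrom (λ l → ⟦ periodic t m l ⟧ * 2 ^ l) o n ≤ periodicSum t m
sumFrom-periodic≤ t zero    o n = ≤-reflexive (sumFrom-const _ 0 o n λ _ _ _ → refl)
sumFrom-periodic≤ t (suc m) o n = ≤-trans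
  (sumFrom-∨ (periodic t m) (_≡ᵇ t + 1 + 3 * m) (2 ^_) o n)
  (+-mono-≤ (sumFrom-periodic≤ t m o n)
            (sumFrom-single (_≡ᵇ t + 1 + 3 * m) (2 ^_) (t + 1 + 3 * m) o n λ _ → ≡ᵇ⇒≡-true))

7*periodicSum+2^[t+1] : ∀ t m → 7 * periodicSum t m + 2 ^ (t + 1) ≡ 2 ^ (t + 1) * 8 ^ m
7*periodicSum+2^[t+1] t zero    = sym (*-identityʳ _)
7*periodicSum+2^[t+1] t (suc m) = begin
  7 * (periodicSum t m + 2 ^ (t + 1 + 3 * m)) + 2 ^ (t + 1)
    ≡⟨ cong (λ z → 7 * (periodicSum t m + z) + 2 ^ (t + 1)) 2^[t+1+3m] ⟩
  7 * (periodicSum t m + 2 ^ (t + 1) * 8 ^ m) + 2 ^ (t + 1)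
    ≡⟨ regroup (periodicSum t m) (2 ^ (t + 1)) (8 ^ m) ⟩
  (7 * periodicSum t m + 2 ^ (t + 1)) + 7 * (2 ^ (t + 1) * 8 ^ m)
    ≡⟨ cong (_+ 7 * (2 ^ (t + 1) * 8 ^ m)) (7*periodicSum+2^[t+1] t m) ⟩
  2 ^ (t + 1) * 8 ^ m + 7 * (2 ^ (t + 1) * 8 ^ m)
    ≡⟨ eightfold (2 ^ (t + 1)) (8 ^ m) ⟩
  2 ^ (t + 1) * 8 ^ suc m ∎
  where
  open ≡-Reasoning
  2^[t+1+3m] : 2 ^ (t + 1 + 3 * m) ≡ 2 ^ (t + 1) * 8 ^ m
  2^[t+1+3m] = trans (^-distribˡ-+-* 2 (t + 1) (3 * m)) (cong (2 ^ (t + 1) *_) (sym (^-*-assoc 2 3 m)))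
  regroup : ∀ a b c → 7 * (a + b * c) + b ≡ (7 * a + b) + 7 * (b * c)
  regroup = solve-∀
  eightfold : ∀ b c → b * c + 7 * (b * c) ≡ b * (8 * c)
  eightfold = solve-∀

periodicSum≡ : ∀ t m → (2 ^ (t + 1) * (8 ^ m ∸ 1)) / 7 ≡ periodicSum t m
periodicSum≡ t m = trans (cong (_/ 7) 7∣) (m*n/n≡m (periodicSum t m) 7)
  where
  7∣ : 2 ^ (t + 1) * (8 ^ m ∸ 1) ≡ periodicSum t m * 7
  7∣ = begin
    2 ^ (t + 1) * (8 ^ m ∸ 1)                    ≡⟨ *-distribˡ-∸ (2 ^ (t + 1)) (8 ^ m) 1 ⟩
    2 ^ (t + 1) * 8 ^ m ∸ 2 ^ (t + 1) * 1        ≡⟨ cong₂ _∸_ (sym (7*periodicSum+2^[t+1] t m)) (*-identityʳ (2 ^ (t + 1))) ⟩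
    7 * periodicSum t m + 2 ^ (t + 1) ∸ 2 ^ (t + 1) ≡⟨ m+n∸n≡m (7 * periodicSum t m) (2 ^ (t + 1)) ⟩
    7 * periodicSum t m                          ≡⟨ *-comm 7 (periodicSum t m) ⟩
    periodicSum t m * 7                          ∎
    where open ≡-Reasoning

module Construction (m t : ℕ) where

  h : ℕ
  h = 3 * m + t

  chosen : ℕ → Bool
  chosen l = (l ≡ᵇ 0) ∨ ((suc l ≡ᵇ h) ∨ periodic t m l)

  extra : ℕ → Bool
  extra x = (t ≡ᵇ 2) ∧ (x ≡ᵇ 1)

  member : ℕ → Bool
  member x = extra x ∨ atDepth chosen (suc h) 0 x

  open Balls h member public

  member-level : ∀ {L s} → L ≤ h → s < 2 ^ L → chosen L ≡ true → member (levelStart L + s) ≡ true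
  member-level {L} {s} L≤h s< chosen-L = trans
    (cong (extra (levelStart L + s) ∨_) (trans
      (atDepth-level chosen (suc h) z≤n (s≤s L≤h) (m≤m+n (levelStart L) s)
        (subst (levelStart L + s <_) (sym (levelStart-suc L)) (+-monoʳ-< (levelStart L) s<)))
      chosen-L))
    (∨-zeroʳ _)

  chosen-periodic : ∀ {l} i → i < m → t + 1 + 3 * i ≡ l → chosen l ≡ true
  chosen-periodic {l} i i<m refl = trans
    (cong ((l ≡ᵇ 0) ∨_) (trans (cong ((suc l ≡ᵇ h) ∨_) (periodic-hit t m i i<m)) (∨-zeroʳ _)))
    (∨-zeroʳ _)

  chosen-admissible : t ≤ 2 → 1 ≤ m → AdmissibleLevels h chosen
  chosen-admissible t≤2 1≤m = record
    { root∈   = refl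
    ; h∸1∈    = λ l 1+l≡h → trans (cong ((l ≡ᵇ 0) ∨_) (cong (_∨ periodic t m l) (≡⇒≡ᵇ-true 1+l≡h))) (∨-zeroʳ _)
    ; h∸2∈    = h∸2∈′ 1≤m
    ; window∈ = window∈′
    }
    where
    h∸2∈′ : 1 ≤ m → ∀ l → suc (suc l) ≡ h → chosen l ≡ true
    h∸2∈′ (s≤s {n = m′} _) l 2+l≡h =
      chosen-periodic m′ ≤-refl (suc-injective (suc-injective (trans (last≡ m′ t) (sym 2+l≡h))))
      where
      last≡ : ∀ m′ t → suc (suc (t + 1 + 3 * m′)) ≡ 3 * suc m′ + t
      last≡ = solve-∀
    window∈′ : ∀ l → l + 3 ≤ h → chosen l ≡ true ⊎ chosen (suc l) ≡ true ⊎ chosen (suc (suc l)) ≡ true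
    window∈′ zero     _    = inj₁ refl
    window∈′ (suc l) l+3≤ with periodic-near t m (suc l) (≤-trans t≤2 (s≤s 1≤suc)) l+3≤
    ... | i , i<m , 0 , _ , hit≡ =
      inj₂ (inj₂ (chosen-periodic i i<m (trans (sym (+-identityʳ _)) hit≡)))
    ... | i , i<m , 1 , _ , hit≡ =
      inj₂ (inj₁ (chosen-periodic i i<m (suc-injective (trans (+-comm 1 _) hit≡))))
    ... | i , i<m , 2 , _ , hit≡ =
      inj₁ (chosen-periodic i i<m (suc-injective (suc-injective (trans (+-comm 2 _) hit≡))))
    ... | _ , _ , suc (suc (suc _)) , s≤s (s≤s (s≤s ())) , _

  t≡2 : 1 ≤ m → t ≤ 2 → chosen 1 ≡ false → chosen 2 ≡ false → t ≡ 2
  t≡2 1≤m t≤2 not1 not2 = helper t t≤2 (chosen-periodic 0 1≤m refl)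
    where
    helper : ∀ t′ → t′ ≤ 2 → chosen (t′ + 1 + 0) ≡ true → t′ ≡ 2
    helper 0 _ hit with () ← trans (sym hit) not1
    helper 1 _ hit with () ← trans (sym hit) not2
    helper 2 _ _   = refl
    helper (suc (suc (suc _))) (s≤s (s≤s ())) _

  -- For t = 2 neither level 1 nor level 2 is chosen, so N_2[root] needs the extra vertex 1.
  root-pair≤ballCount : t ≡ 2 → 1 ≤ h → ∀ v → toℕ v ≡ 0 → 2 ≤ ballCount (T h) S 2 v
  root-pair≤ballCount refl 1≤h v v≡0 =
    intervals≤ballCount {a₁ = 0} {1} {1} {1} ≤-refl
      (levelStart+offset< {h} {1} {0} 1≤h (s≤s z≤n)) counted-root counted-extra
    where
    counted-root : ∀ x → 0 ≤ x → x < 1 → Counted 2 v x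
    counted-root zero _ _ = member-level z≤n (s≤s z≤n) refl , subst (Near 2 0) (sym v≡0) (near-mono z≤n (near-refl 0))
    counted-root (suc _) _ (s≤s ())
    counted-extra : ∀ x → 1 ≤ x → x < 2 → Counted 2 v x
    counted-extra 1 _ _ = refl , subst (Near 2 1) (sym v≡0)
      (near-mono (s≤s z≤n) (near-parent (levelStart+offset< {h} {1} {0} 1≤h (s≤s z≤n)) refl (near-refl 1)))
    counted-extra (suc (suc _)) _ (s≤s (s≤s ()))

  multicover : t ≤ 2 → 1 ≤ m → 4 ≤ h → IsMulticover (T h) S
  multicover t≤2 1≤m 4≤h v r 1≤r r≤ecc
    with position-of h (toℕ v) (subst (toℕ v <_) (∣T∣≡levelStart h) (toℕ<n v))
  ... | position d s d≤h s< v≡ =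
    ball≥radius h d r 4≤h d≤h 1≤r (≤-trans r≤ecc (ecc≤height+depth v v≡ s< d≤h))
      (chosen-admissible t≤2 1≤m) bounds
    where
    block-at : ∀ j k L → j ≤ d → L + j ≡ d + k → L ≤ h → chosen L ≡ true → j + k ≤ r → CountedBlock r v L k
    block-at j k L j≤d L+j≡ L≤h chosen-L =
      ancestor-block v≡ s< d≤h j k L j≤d L+j≡ L≤h (λ q q< → member-level L≤h q< chosen-L)
    bounds : BallBounds (ballCount (T h) S r v) h d r chosen
    bounds = record
      { block     = λ j k L j≤d L+j≡ L≤h chosen-L j+k≤r →
          block≤ballCount (block-at j k L j≤d L+j≡ L≤h chosen-L j+k≤r) L≤h
      ; blocks    = λ j₁ k₁ L₁ j₂ k₂ L₂ j₁≤d L₁+j₁≡ chosen-L₁ j₁+k₁≤r j₂≤d L₂+j₂≡ L₂≤h chosen-L₂ j₂+k₂≤r L₁<L₂ →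
          blocks≤ballCount
            (block-at j₁ k₁ L₁ j₁≤d L₁+j₁≡ (≤-trans (<⇒≤ L₁<L₂) L₂≤h) chosen-L₁ j₁+k₁≤r)
            (block-at j₂ k₂ L₂ j₂≤d L₂+j₂≡ L₂≤h chosen-L₂ j₂+k₂≤r) L₁<L₂ L₂≤h
      ; root-pair = root-bound
      }
      where
      root-bound : d ≡ 0 → r ≡ 2 → chosen 1 ≡ false → chosen 2 ≡ false → 2 ≤ ballCount (T h) S r v
      root-bound refl refl not1 not2 =
        root-pair≤ballCount (t≡2 1≤m t≤2 not1 not2) (≤-trans 1≤suc 4≤h) v (trans v≡ (n<1⇒n≡0 s<))

  levelWeight : ℕ → ℕ
  levelWeight l = ⟦ chosen l ⟧ * 2 ^ l

  countFrom-atDepth : ∀ L → L ≤ suc h →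
    countFrom (atDepth chosen (suc h) 0) 0 (levelStart L) ≡ sumFrom levelWeight 0 L
  countFrom-atDepth zero    _   = refl
  countFrom-atDepth (suc L) L<h = begin
    countFrom Q 0 (levelStart (suc L))                      ≡⟨ cong (countFrom Q 0) (levelStart-suc L) ⟩
    countFrom Q 0 (levelStart L + 2 ^ L)                    ≡⟨ sumFrom-++ (⟦_⟧ ∘ Q) 0 (levelStart L) (2 ^ L) ⟩
    countFrom Q 0 (levelStart L) + countFrom Q (levelStart L) (2 ^ L)
      ≡⟨ cong₂ _+_ (countFrom-atDepth L (≤-trans (n≤1+n L) L<h)) (sumFrom-const (⟦_⟧ ∘ Q) ⟦ chosen L ⟧ _ (2 ^ L) level-L) ⟩
    sumFrom levelWeight 0 L + levelWeight L                 ≡⟨ sumFrom-snoc levelWeight 0 L ⟨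
    sumFrom levelWeight 0 (suc L)                           ∎
    where
    open ≡-Reasoning
    Q = atDepth chosen (suc h) 0
    level-L : ∀ x → levelStart L ≤ x → x < levelStart L + 2 ^ L → ⟦ Q x ⟧ ≡ ⟦ chosen L ⟧
    level-L x start≤x x< = cong ⟦_⟧ (atDepth-level chosen (suc h) z≤n L<h start≤x
                                      (subst (x <_) (sym (levelStart-suc L)) x<))

  sumFrom-levelWeight≤ : sumFrom levelWeight 0 (suc h) ≤ 1 + (2 ^ (h ∸ 1) + periodicSum t m)
  sumFrom-levelWeight≤ = begin
    sumFrom levelWeight 0 (suc h)
      ≤⟨ sumFrom-∨ (_≡ᵇ 0) (λ l → (suc l ≡ᵇ h) ∨ periodic t m l) (2 ^_) 0 (suc h) ⟩
    sumFrom (λ l → ⟦ l ≡ᵇ 0 ⟧ * 2 ^ l) 0 (suc h) + sumFrom (λ l → ⟦ (suc l ≡ᵇ h) ∨ periodic t m l ⟧ * 2 ^ l) 0 (suc h)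
      ≤⟨ +-monoʳ-≤ (sumFrom (λ l → ⟦ l ≡ᵇ 0 ⟧ * 2 ^ l) 0 (suc h)) (sumFrom-∨ (λ l → suc l ≡ᵇ h) (periodic t m) (2 ^_) 0 (suc h)) ⟩
    sumFrom (λ l → ⟦ l ≡ᵇ 0 ⟧ * 2 ^ l) 0 (suc h) +
      (sumFrom (λ l → ⟦ suc l ≡ᵇ h ⟧ * 2 ^ l) 0 (suc h) + sumFrom (λ l → ⟦ periodic t m l ⟧ * 2 ^ l) 0 (suc h))
      ≤⟨ +-mono-≤ (sumFrom-single (_≡ᵇ 0) (2 ^_) 0 0 (suc h) λ _ → ≡ᵇ⇒≡-true)
           (+-mono-≤ (sumFrom-single (λ l → suc l ≡ᵇ h) (2 ^_) (h ∸ 1) 0 (suc h) λ l e → cong (_∸ 1) (≡ᵇ⇒≡-true {suc l} {h} e))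
                     (sumFrom-periodic≤ t m 0 (suc h))) ⟩
    1 + (2 ^ (h ∸ 1) + periodicSum t m) ∎
    where open ≤-Reasoning

  countFrom-extra≤ : ∀ n → countFrom (λ x → (t ≡ᵇ 2) ∧ (x ≡ᵇ 1)) 0 n ≤ ⟦ t ≡ᵇ 2 ⟧
  countFrom-extra≤ n with t ≡ᵇ 2
  ... | false = ≤-reflexive (sumFrom-const _ 0 0 n λ _ _ _ → refl)
  ... | true  = ≤-trans (sumFrom-mono 0 n λ x → ≤-reflexive (sym (*-identityʳ ⟦ x ≡ᵇ 1 ⟧)))
                        (sumFrom-single (_≡ᵇ 1) (λ _ → 1) 1 0 n λ _ → ≡ᵇ⇒≡-true)

  size : t ≤ 2 → ∣ S ∣ ≤ (2 ^ (t + 1) * (8 ^ m ∸ 1)) / 7 + 2 ^ (h ∸ 1) + b t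
  size t≤2 = begin
    ∣ S ∣                                                ≡⟨ ∣tabulate∣≡countFrom N member ⟩
    countFrom member 0 N                                 ≡⟨ cong (countFrom member 0) (∣T∣≡levelStart h) ⟩
    countFrom member 0 (levelStart (suc h))              ≤⟨ countFrom-∨ extra (atDepth chosen (suc h) 0) 0 (levelStart (suc h)) ⟩
    countFrom extra 0 (levelStart (suc h)) + countFrom (atDepth chosen (suc h) 0) 0 (levelStart (suc h))
      ≤⟨ +-mono-≤ (countFrom-extra≤ (levelStart (suc h))) (≤-reflexive (countFrom-atDepth (suc h) ≤-refl)) ⟩
    ⟦ t ≡ᵇ 2 ⟧ + sumFrom levelWeight 0 (suc h)           ≤⟨ +-monoʳ-≤ ⟦ t ≡ᵇ 2 ⟧ sumFrom-levelWeight≤ ⟩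
    ⟦ t ≡ᵇ 2 ⟧ + (1 + (2 ^ (h ∸ 1) + periodicSum t m))    ≡⟨ regroup ⟦ t ≡ᵇ 2 ⟧ (2 ^ (h ∸ 1)) (periodicSum t m) ⟩
    periodicSum t m + 2 ^ (h ∸ 1) + (1 + ⟦ t ≡ᵇ 2 ⟧)     ≡⟨ cong₂ (λ a c → a + 2 ^ (h ∸ 1) + c) (sym (periodicSum≡ t m)) (b≡ t t≤2) ⟩
    (2 ^ (t + 1) * (8 ^ m ∸ 1)) / 7 + 2 ^ (h ∸ 1) + b t ∎
    where
    open ≤-Reasoning
    regroup : ∀ a c p → a + (1 + (c + p)) ≡ p + c + (1 + a)
    regroup = solve-∀
    b≡ : ∀ t → t ≤ 2 → 1 + ⟦ t ≡ᵇ 2 ⟧ ≡ b t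
    b≡ 0 _ = refl
    b≡ 1 _ = refl
    b≡ 2 _ = refl
    b≡ (suc (suc (suc _))) (s≤s (s≤s ()))

mainTheorem11 : ∀ (m t : ℕ) → t ≤ 2 → 4 ≤ 3 * m + t →
    McAtMost (T (3 * m + t))
      ((2 ^ (t + 1) * (8 ^ m ∸ 1)) / 7 + 2 ^ ((3 * m + t) ∸ 1) + b t)
mainTheorem11 zero    t t≤2 4≤t with s≤s (s≤s ()) ← ≤-trans 4≤t t≤2
mainTheorem11 (suc m) t t≤2 4≤h =
  S , multicover t≤2 (s≤s z≤n) 4≤h , size t≤2
  where open Construction (suc m) t
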